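{- Let $G$ be an MP-digraph. Then the multipath matroid $M_G$ is binary, i.e. representable over the field $\mathbb F_2$.
   Context: Digraphs: finite, at most one edge $(v,w)$ from $v$ to $w$ for distinct $v,w$, loops allowed. A multipath of $G$ is a spanning subgraph each connected component of which is a vertex or a simple path (a sequence of non-loop edges $e_1,\dots,e_n$ with target of $e_i$ = source of $e_{i+1}$, no repeated vertices, not closing into a cycle); $\mathrm{Mult}(G)$ is the set of multipaths identified with their edge sets, and $M_G=(E(G),\mathrm{Mult}(G))$. An MP-digraph is a digraph $G$ such that (MP1) $G$ has no subgraph isomorphic to $D_A$ (vertices $v_0,v_1,v_2$, edges $(v_1,v_0),(v_0,v_2),(v_1,v_2)$) or $D_B$ (vertices $v_0,\dots,v_3$, edges $(v_0,v_1),(v_2,v_1),(v_2,v_3)$) or their edge-reversals, and (MP2) every coherently oriented cycle of length $\ge 2$ is a connected component; then $M_G$ is a matroid. A matroid on $X$ is representable over a field $\mathbb F$ if there is a matrix over $\mathbb F$ and a bijection from $X$ to its columns under which independent sets correspond to linearly independent sets of columns. -}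

module Defs where

open import Data.Nat using (ℕ; zero; suc)
open import Data.Fin using (Fin; zero; suc; inject₁; fromℕ)
open import Data.Fin.Subset using (Subset; _∈_)
open import Data.Bool using (Bool; true; false; _xor_; _∧_)
open import Data.Product using (Σ; ∃; ∃-syntax; _×_; _,_)
open import Data.Sum using (_⊎_)
open import Relation.Binary.PropositionalEquality using (_≡_; _≢_)
open import Relation.Nullary using (¬_)

-- Loops (src e ≡ tgt e) are allowed (possibly several), but
-- between distinct v, w there is at most one edge from v to w.

record Digraph : Set where
  field
    nV   : ℕ
    nE   : ℕ
    src  : Fin nE → Fin nV
    tgt  : Fin nE → Fin nV
    simple : ∀ e f → src e ≢ tgt e → src e ≡ src f → tgt e ≡ tgt f → e ≡ f

open Digraph public

Adj : (G : Digraph) → Fin (nV G) → Fin (nV G) → Set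
Adj G v w = ∃[ e ] (src G e ≡ v × tgt G e ≡ w)

record SimplePath (G : Digraph) : Set where
  field
    len    : ℕ                                   -- number of edges minus one
    vert   : Fin (suc (suc len)) → Fin (nV G)
    edge   : Fin (suc len) → Fin (nE G)
    vert-inj : ∀ i j → vert i ≡ vert j → i ≡ j
    edge-src : ∀ i → src G (edge i) ≡ vert (inject₁ i)
    edge-tgt : ∀ i → tgt G (edge i) ≡ vert (suc i)

open SimplePath public

-- A set S of edges is a multipath iff the spanning subgraph with edge
-- set S has every connected component a single vertex or a simple path,
-- i.e. S is the edge set of a family of pairwise vertex-disjoint simple
-- paths (the remaining vertices being isolated).
IsMultipath : (G : Digraph) → Subset (nE G) → Set
IsMultipath G S =
  Σ ℕ λ p → Σ (Fin p → SimplePath G) λ P →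
    (∀ a b i j → vert (P a) i ≡ vert (P b) j → a ≡ b)
    × (∀ e → e ∈ S → ∃[ a ] ∃[ i ] edge (P a) i ≡ e)
    × (∀ a i → edge (P a) i ∈ S)

HasDA : Digraph → Set
HasDA G = ∃[ v0 ] ∃[ v1 ] ∃[ v2 ]
  (v0 ≢ v1 × v0 ≢ v2 × v1 ≢ v2 ×
   Adj G v1 v0 × Adj G v0 v2 × Adj G v1 v2)

HasDArev : Digraph → Set
HasDArev G = ∃[ v0 ] ∃[ v1 ] ∃[ v2 ]
  (v0 ≢ v1 × v0 ≢ v2 × v1 ≢ v2 ×
   Adj G v0 v1 × Adj G v2 v0 × Adj G v2 v1)

HasDB : Digraph → Set
HasDB G = ∃[ v0 ] ∃[ v1 ] ∃[ v2 ] ∃[ v3 ]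
  (v0 ≢ v1 × v0 ≢ v2 × v0 ≢ v3 × v1 ≢ v2 × v1 ≢ v3 × v2 ≢ v3 ×
   Adj G v0 v1 × Adj G v2 v1 × Adj G v2 v3)

HasDBrev : Digraph → Set
HasDBrev G = ∃[ v0 ] ∃[ v1 ] ∃[ v2 ] ∃[ v3 ]
  (v0 ≢ v1 × v0 ≢ v2 × v0 ≢ v3 × v1 ≢ v2 × v1 ≢ v3 × v2 ≢ v3 ×
   Adj G v1 v0 × Adj G v1 v2 × Adj G v3 v2)

MP1 : Digraph → Set
MP1 G = ¬ HasDA G × ¬ HasDArev G × ¬ HasDB G × ¬ HasDBrev G

record Cycle (G : Digraph) : Set where
  field
    clen   : ℕ
    cyc    : Fin (suc (suc clen)) → Fin (nV G)
    cyc-inj : ∀ i j → cyc i ≡ cyc j → i ≡ j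
    cyc-step : ∀ i → Adj G (cyc (inject₁ i)) (cyc (suc i))
    cyc-close : Adj G (cyc (fromℕ (suc clen))) (cyc zero)

open Cycle public

IsCycleEdge : (G : Digraph) → Cycle G → Fin (nE G) → Set
IsCycleEdge G C e =
  (∃[ i ] (src G e ≡ cyc C (inject₁ i) × tgt G e ≡ cyc C (suc i)))
  ⊎ (src G e ≡ cyc C (fromℕ (suc (clen C))) × tgt G e ≡ cyc C zero)

IsComponent : (G : Digraph) → Cycle G → Set
IsComponent G C = ∀ e →
  ((∃[ i ] src G e ≡ cyc C i) ⊎ (∃[ i ] tgt G e ≡ cyc C i)) →
  IsCycleEdge G C e

MP2 : Digraph → Set
MP2 G = (C : Cycle G) → IsComponent G C

IsMPDigraph : Digraph → Set
IsMPDigraph G = MP1 G × MP2 G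

sumF2 : ∀ {k} → (Fin k → Bool) → Bool
sumF2 {zero}  f = false
sumF2 {suc k} f = f zero xor sumF2 (λ j → f (suc j))

LinIndepF2 : ∀ {r m} → (Fin r → Fin m → Bool) → Subset m → Set
LinIndepF2 A S =
  ∀ (c : Fin _ → Bool) →
    (∀ e → c e ≡ true → e ∈ S) →
    (∀ i → sumF2 (λ e → c e ∧ A i e) ≡ false) →
    ∀ e → c e ≡ false

BinaryRepresentable : (m : ℕ) → (Subset m → Set) → Set
BinaryRepresentable m Ind =
  ∃[ r ] Σ (Fin r → Fin m → Bool) λ A →
    ∀ (S : Subset m) → (Ind S → LinIndepF2 A S) × (LinIndepF2 A S → Ind S)

{-# OPTIONS --safe #-}
-- Give every edge of G a column over F₂.  A non-loop edge sharing its source with another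
-- non-loop edge ("fan-out") gets the unit vector of its source; otherwise one sharing its
-- target ("fan-in") gets the unit vector of its target; the remaining "plain" edges get their
-- vertex-incidence vectors, and loops the zero column.
--
-- In a vanishing combination of the columns of a multipath, a fan edge is alone in its row and
-- a plain edge can only cancel against the next edge of its path, so a nonzero coefficient
-- would travel along its path to the last edge, where nothing cancels it.  Conversely, an
-- independent set has no loop and no two parallel columns, hence in- and out-degrees at most
-- one (MP1 is what puts two edges with a common target into the fan-in class), and no cycle,
-- because by MP2 a cycle is a whole component of plain edges whose incidence vectors add up
-- to zero.  Such an edge set decomposes into disjoint paths by walking forward from every
-- vertex that has an outgoing but no incoming edge.
module Submission where

open import Defs

open import Data.Bool using (Bool; true; false; _xor_; _∧_)
open import Data.Bool.Properties as Bool
  using (¬-not; xor-same; xor-comm; xor-identityʳ; ∧-conicalˡ; ∧-conicalʳ; ∧-zeroʳ)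
open import Data.Empty using (⊥; ⊥-elim)
open import Data.Fin using (Fin; zero; suc; toℕ; inject₁; fromℕ; fromℕ<; splitAt; _↑ˡ_; _↑ʳ_)
open import Data.Fin.Properties
  using (_≟_; suc-injective; toℕ-injective; toℕ-inject₁; inject₁-injective; toℕ-inject; toℕ-fromℕ;
         toℕ-fromℕ<; toℕ<n; any?; ¬∀⟶∃¬-smallest; pigeonhole; splitAt-↑ˡ; splitAt-↑ʳ)
open import Data.Fin.Subset.Properties using (_∈?_)
open import Data.Fin.Subset using (Subset; _∈_)
open import Data.Product as Product using (∃; ∃-syntax; _×_; _,_; proj₁; proj₂)
open import Data.Sum as Sum using (_⊎_; inj₁; inj₂; [_,_]′)
open import Data.Nat using (ℕ; _+_; _∸_; _<_; _≤_; s≤s; z≤n; s≤s⁻¹)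
import Data.Nat.Properties as ℕ
open import Data.Nat.GeneralisedArithmetic using (fold; fold-+; iterate)
open import Function using (_∘_)
open import Relation.Binary.PropositionalEquality
open import Relation.Binary.Definitions using (tri<; tri≈; tri>)
open import Relation.Nullary using (¬_; Dec; yes; no; does; contradiction)
open import Relation.Nullary.Decidable using (_⊎-dec_; _×-dec_; ¬?; dec-true; dec-false; decidable-stable)
open import Relation.Unary using (Decidable)
open import Function.Definitions using (Injective)

does⇒ : ∀ {P : Set} (P? : Dec P) → does P? ≡ true → P
does⇒ (yes p) _ = p

inject₁≢suc : ∀ {n} (i : Fin n) → inject₁ i ≢ suc i
inject₁≢suc i eq = ℕ.1+n≢n (trans (sym (cong toℕ eq)) (toℕ-inject₁ i))

inject₁-or-fromℕ : ∀ {n} (k : Fin (ℕ.suc n)) → (∃[ i ] k ≡ inject₁ i) ⊎ k ≡ fromℕ n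
inject₁-or-fromℕ {ℕ.zero}  zero    = inj₂ refl
inject₁-or-fromℕ {ℕ.suc n} zero    = inj₁ (zero , refl)
inject₁-or-fromℕ {ℕ.suc n} (suc k) = Sum.map (Product.map suc (cong suc)) (cong suc) (inject₁-or-fromℕ k)

first-failure : ∀ {P : ℕ → Set} → Decidable P → ∀ n → ¬ (∀ {k} → k < n → P k) →
                ∃[ m ] (m < n × ¬ P m × (∀ {k} → k < m → P k))
first-failure {P} P? n ¬all
  with ¬∀⟶∃¬-smallest n (P ∘ toℕ) (P? ∘ toℕ)
         (λ all → ¬all (λ k<n → subst P (toℕ-fromℕ< k<n) (all (fromℕ< k<n))))
... | m , ¬Pm , below =
  toℕ m , toℕ<n m , ¬Pm ,
  λ k<m → subst P (trans (toℕ-inject (fromℕ< k<m)) (toℕ-fromℕ< k<m)) (below (fromℕ< k<m))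

record Enumeration {n} (P : Fin n → Set) : Set where
  field
    size            : ℕ
    elem            : Fin size → Fin n
    elem-satisfies  : ∀ a → P (elem a)
    elem-injective  : Injective _≡_ _≡_ elem
    elem-surjective : ∀ {x} → P x → ∃[ a ] elem a ≡ x

enumerate : ∀ {n} {P : Fin n → Set} → Decidable P → Enumeration P
enumerate {ℕ.zero} P? = record
  { size = 0 ; elem = λ () ; elem-satisfies = λ ()
  ; elem-injective = λ { {()} } ; elem-surjective = λ { {()} } }
enumerate {ℕ.suc n} {P} P? with P? zero
... | no ¬P0 = record
  { size = size ; elem = suc ∘ elem ; elem-satisfies = elem-satisfies
  ; elem-injective = elem-injective ∘ suc-injective ; elem-surjective = surjective }
  where
  open Enumeration (enumerate (P? ∘ suc))
  surjective : ∀ {x} → P x → ∃[ a ] suc (elem a) ≡ x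
  surjective {zero}  P0 = contradiction P0 ¬P0
  surjective {suc x} Px = Product.map₂ (cong suc) (elem-surjective Px)
... | yes P0 = record
  { size = ℕ.suc size ; elem = elem′ ; elem-satisfies = satisfies
  ; elem-injective = injective ; elem-surjective = surjective }
  where
  open Enumeration (enumerate (P? ∘ suc))
  elem′ : Fin (ℕ.suc size) → Fin (ℕ.suc n)
  elem′ zero    = zero
  elem′ (suc a) = suc (elem a)
  satisfies : ∀ a → P (elem′ a)
  satisfies zero    = P0
  satisfies (suc a) = elem-satisfies a
  injective : Injective _≡_ _≡_ elem′
  injective {zero}  {zero}  _  = refl
  injective {suc a} {suc b} eq = cong suc (elem-injective (suc-injective eq))
  surjective : ∀ {x} → P x → ∃[ a ] elem′ a ≡ x
  surjective {zero}  _  = zero , refl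
  surjective {suc x} Px = Product.map suc (cong suc) (elem-surjective Px)

sumF2-zero : ∀ {k} (f : Fin k → Bool) → (∀ x → f x ≡ false) → sumF2 f ≡ false
sumF2-zero {ℕ.zero}  f z = refl
sumF2-zero {ℕ.suc k} f z rewrite z zero = sumF2-zero (f ∘ suc) (z ∘ suc)

sumF2-single : ∀ {k} (f : Fin k → Bool) {x₀} →
               (∀ {x} → f x ≡ true → x ≡ x₀) → sumF2 f ≡ f x₀
sumF2-single f {zero} only = begin
  f zero xor sumF2 (f ∘ suc) ≡⟨ cong (f zero xor_) (sumF2-zero (f ∘ suc) λ _ → ¬-not ((λ ()) ∘ only)) ⟩
  f zero xor false           ≡⟨ xor-identityʳ (f zero) ⟩
  f zero                     ∎
  where open ≡-Reasoning
sumF2-single f {suc x₀} only rewrite ¬-not {f zero} ((λ ()) ∘ only) =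
  sumF2-single (f ∘ suc) (suc-injective ∘ only)

sumF2-pair : ∀ {k} (f : Fin k → Bool) {x₀ x₁} → x₀ ≢ x₁ →
             (∀ {x} → f x ≡ true → x ≡ x₀ ⊎ x ≡ x₁) → sumF2 f ≡ f x₀ xor f x₁
sumF2-pair f {zero} {zero} x₀≢x₁ only = contradiction refl x₀≢x₁
sumF2-pair f {zero} {suc x₁} _ only =
  cong (f zero xor_) (sumF2-single (f ∘ suc) ([ (λ ()) , suc-injective ]′ ∘ only))
sumF2-pair f {suc x₀} {zero} _ only =
  trans (cong (f zero xor_) (sumF2-single (f ∘ suc) ([ suc-injective , (λ ()) ]′ ∘ only)))
        (xor-comm (f zero) (f (suc x₀)))
sumF2-pair f {suc x₀} {suc x₁} x₀≢x₁ only
  rewrite ¬-not {f zero} ([ (λ ()) , (λ ()) ]′ ∘ only) =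
  sumF2-pair (f ∘ suc) (x₀≢x₁ ∘ cong suc)
    (Sum.map suc-injective suc-injective ∘ only)

sumF2-off-support : ∀ {k} (c a : Fin k → Bool) → (∀ x → c x ≡ true → a x ≡ false) →
                    sumF2 (λ x → c x ∧ a x) ≡ false
sumF2-off-support c a off = sumF2-zero _ λ x → vanish (c x) (off x)
  where
  vanish : ∀ b {b′} → (b ≡ true → b′ ≡ false) → b ∧ b′ ≡ false
  vanish true  h = h refl
  vanish false _ = refl

module _ {m} {R : Set} (A : R → Fin m → Bool) where

  InKernel : (Fin m → Bool) → Set
  InKernel c = ∀ r → sumF2 (λ e → c e ∧ A r e) ≡ false

  sole-support-∉-kernel : ∀ {c e} → InKernel c → c e ≡ true → ∀ r → A r e ≡ true →
                          (∀ {f} → c f ≡ true → A r f ≡ true → f ≡ e) → ⊥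
  sole-support-∉-kernel {c} {e} ker ce r Are only = contradiction (begin
    true                        ≡⟨ cong₂ _∧_ ce Are ⟨
    c e ∧ A r e                 ≡⟨ sumF2-single _ (λ t → only (∧-conicalˡ _ _ t) (∧-conicalʳ _ _ t)) ⟨
    sumF2 (λ f → c f ∧ A r f)   ≡⟨ ker r ⟩
    false                       ∎) λ ()
    where open ≡-Reasoning

kernel-reindex : ∀ {m} {R R′ : Set} (A : R → Fin m → Bool) (ρ : R′ → R) →
                 (∀ r → ∃[ i ] ρ i ≡ r) → ∀ {c} → InKernel (A ∘ ρ) c → InKernel A c
kernel-reindex A ρ ρ-surjective ker r with ρ-surjective r
... | i , refl = ker i

module _ {n m} (A : Fin n → Fin m → Bool) {S : Subset m} (indep : LinIndepF2 A S) where

  independent⇒column≢0 : ∀ {e} → e ∈ S → ¬ (∀ i → A i e ≡ false)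
  independent⇒column≢0 {e} e∈S zero-column =
    contradiction (trans (sym (dec-true (e ≟ e) refl)) (indep c support kernel e)) λ ()
    where
    open ≡-Reasoning
    c : Fin m → Bool
    c x = does (x ≟ e)
    support : ∀ x → c x ≡ true → x ∈ S
    support x cx = subst (_∈ S) (sym (does⇒ (x ≟ e) cx)) e∈S
    kernel : InKernel A c
    kernel i = begin
      sumF2 (λ x → c x ∧ A i x) ≡⟨ sumF2-single _ (does⇒ (_ ≟ e) ∘ ∧-conicalˡ _ _) ⟩
      c e ∧ A i e               ≡⟨ cong (c e ∧_) (zero-column i) ⟩
      c e ∧ false               ≡⟨ ∧-zeroʳ (c e) ⟩
      false                     ∎

  independent⇒¬parallel : ∀ {e f} → e ∈ S → f ∈ S → e ≢ f → ¬ (∀ i → A i e ≡ A i f)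
  independent⇒¬parallel {e} {f} e∈S f∈S e≢f same =
    contradiction (trans (sym ce) (indep c support kernel e)) λ ()
    where
    open ≡-Reasoning
    c : Fin m → Bool
    c x = does ((x ≟ e) ⊎-dec (x ≟ f))
    ce : c e ≡ true
    ce = dec-true ((e ≟ e) ⊎-dec (e ≟ f)) (inj₁ refl)
    cf : c f ≡ true
    cf = dec-true ((f ≟ e) ⊎-dec (f ≟ f)) (inj₂ refl)
    support : ∀ x → c x ≡ true → x ∈ S
    support x cx = [ (λ x≡e → subst (_∈ S) (sym x≡e) e∈S) , (λ x≡f → subst (_∈ S) (sym x≡f) f∈S) ]′
      (does⇒ ((x ≟ e) ⊎-dec (x ≟ f)) cx)
    only : ∀ {i x} → c x ∧ A i x ≡ true → x ≡ e ⊎ x ≡ f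
    only {x = x} = does⇒ ((x ≟ e) ⊎-dec (x ≟ f)) ∘ ∧-conicalˡ _ _
    kernel : InKernel A c
    kernel i = begin
      sumF2 (λ x → c x ∧ A i x)        ≡⟨ sumF2-pair _ e≢f only ⟩
      (c e ∧ A i e) xor (c f ∧ A i f)  ≡⟨ cong₂ (λ a b → (a ∧ A i e) xor (b ∧ A i f)) ce cf ⟩
      A i e xor A i f                  ≡⟨ cong (A i e xor_) (same i) ⟨
      A i e xor A i e                  ≡⟨ xor-same (A i e) ⟩
      false                            ∎

path-edge-nonloop : ∀ {G} (P : SimplePath G) i → src G (edge P i) ≢ tgt G (edge P i)
path-edge-nonloop P i eq =
  inject₁≢suc i (vert-inj P _ _ (trans (sym (edge-src P i)) (trans eq (edge-tgt P i))))

module MultipathEdges {G : Digraph} {S : Subset (nE G)} (mp : IsMultipath G S) where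

  P : Fin (proj₁ mp) → SimplePath G
  P = proj₁ (proj₂ mp)

  same-position : ∀ {a b x y} → vert (P b) x ≡ vert (P a) y → b ≡ a × toℕ x ≡ toℕ y
  same-position {a} {b} {x} {y} eq with proj₁ (proj₂ (proj₂ mp)) b a x y eq
  ... | refl = refl , cong toℕ (vert-inj (P a) x y eq)

  on-path : ∀ {f} → f ∈ S → ∃[ b ] ∃[ j ] edge (P b) j ≡ f
  on-path = proj₁ (proj₂ (proj₂ (proj₂ mp))) _

  src-unique : ∀ {a i f} → f ∈ S → src G f ≡ src G (edge (P a) i) → f ≡ edge (P a) i
  src-unique {a} {i} f∈S eq with on-path f∈S
  ... | b , j , refl with same-position (trans (sym (edge-src (P b) j)) (trans eq (edge-src (P a) i)))
  ... | refl , j≡i = cong (edge (P a)) (inject₁-injective (toℕ-injective j≡i))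

  tgt-unique : ∀ {a i f} → f ∈ S → tgt G f ≡ tgt G (edge (P a) i) → f ≡ edge (P a) i
  tgt-unique {a} {i} f∈S eq with on-path f∈S
  ... | b , j , refl with same-position (trans (sym (edge-tgt (P b) j)) (trans eq (edge-tgt (P a) i)))
  ... | refl , j≡i = cong (edge (P a)) (suc-injective (toℕ-injective j≡i))

  next-edge : ∀ {a i f} → f ∈ S → src G f ≡ tgt G (edge (P a) i) →
              ∃[ j ] (toℕ j ≡ ℕ.suc (toℕ i) × f ≡ edge (P a) j)
  next-edge {a} {i} f∈S eq with on-path f∈S
  ... | b , j , refl with same-position (trans (sym (edge-src (P b) j)) (trans eq (edge-tgt (P a) i)))
  ... | refl , j≡i = j , trans (sym (toℕ-inject₁ j)) j≡i , refl

record LinearForest (G : Digraph) (S : Subset (nE G)) : Set where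
  field
    loopless   : ∀ {e} → e ∈ S → src G e ≢ tgt G e
    src-unique : ∀ {e f} → e ∈ S → f ∈ S → src G e ≡ src G f → e ≡ f
    tgt-unique : ∀ {e f} → e ∈ S → f ∈ S → tgt G e ≡ tgt G f → e ≡ f
    acyclic    : (C : Cycle G) → (∀ i → proj₁ (cyc-step C i) ∈ S) → proj₁ (cyc-close C) ∈ S → ⊥

module LinearForestPaths {G : Digraph} {S : Subset (nE G)} (F : LinearForest G S) where
  open LinearForest F

  V : Set
  V = Fin (nV G)

  HasOut HasIn : V → Set
  HasOut v = ∃[ e ] (e ∈ S × src G e ≡ v)
  HasIn  v = ∃[ e ] (e ∈ S × tgt G e ≡ v)

  hasOut? : Decidable HasOut
  hasOut? v = any? (λ e → (e ∈? S) ×-dec (src G e ≟ v))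

  hasIn? : Decidable HasIn
  hasIn? v = any? (λ e → (e ∈? S) ×-dec (tgt G e ≟ v))

  -- next and prev are the identity where S has no edge to follow; Live v k says that the first
  -- k steps of walk v are genuine edges of S.
  next prev : V → V
  next v with hasOut? v
  ... | yes (e , _) = tgt G e
  ... | no _        = v
  prev v with hasIn? v
  ... | yes (e , _) = src G e
  ... | no _        = v

  next-src : ∀ {e} → e ∈ S → next (src G e) ≡ tgt G e
  next-src {e} e∈S with hasOut? (src G e)
  ... | yes (f , f∈S , same) = cong (tgt G) (src-unique f∈S e∈S same)
  ... | no none              = contradiction (e , e∈S , refl) none

  prev-tgt : ∀ {e} → e ∈ S → prev (tgt G e) ≡ src G e
  prev-tgt {e} e∈S with hasIn? (tgt G e)
  ... | yes (f , f∈S , same) = cong (src G) (tgt-unique f∈S e∈S same)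
  ... | no none              = contradiction (e , e∈S , refl) none

  next-prev : ∀ {v} → HasIn v → next (prev v) ≡ v
  next-prev (e , e∈S , refl) = trans (cong next (prev-tgt e∈S)) (next-src e∈S)

  prev-hasOut : ∀ {v} → HasIn v → HasOut (prev v)
  prev-hasOut (e , e∈S , refl) = e , e∈S , sym (prev-tgt e∈S)

  walk : V → ℕ → V
  walk v k = fold v next k

  Live : V → ℕ → Set
  Live v k = ∀ {j} → j < k → HasOut (walk v j)

  live-≤ : ∀ {v k k′} → k ≤ k′ → Live v k′ → Live v k
  live-≤ k≤k′ live j<k = live (ℕ.<-≤-trans j<k k≤k′)

  live-extend : ∀ {v k} → Live v k → HasOut (walk v k) → Live v (ℕ.suc k)
  live-extend live out j<1+k with ℕ.m<1+n⇒m<n∨m≡n j<1+k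
  ... | inj₁ j<k  = live j<k
  ... | inj₂ refl = out

  record Step (v : V) (j : ℕ) : Set where
    field
      step-edge : Fin (nE G)
      step-∈S   : step-edge ∈ S
      step-src  : src G step-edge ≡ walk v j
      step-tgt  : tgt G step-edge ≡ walk v (ℕ.suc j)
  open Step

  walk-step : ∀ {v k j} → Live v k → j < k → Step v j
  walk-step live j<k =
    let e , e∈S , src-e = live j<k in
    record { step-edge = e ; step-∈S = e∈S ; step-src = src-e
           ; step-tgt = trans (sym (next-src e∈S)) (cong next src-e) }

  no-closed-walk : ∀ {u} d → Live u (ℕ.suc d) → walk u (ℕ.suc d) ≡ u →
                   (∀ {a b} → a < ℕ.suc d → b < ℕ.suc d → walk u a ≡ walk u b → a ≡ b) → ⊥
  no-closed-walk {u} ℕ.zero live closed _ =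
    loopless (step-∈S loop) (trans (step-src loop) (trans (sym closed) (sym (step-tgt loop))))
    where
    loop : Step u 0
    loop = walk-step live (s≤s z≤n)
  no-closed-walk {u} (ℕ.suc c) live closed distinct =
    acyclic cycle (λ i → step-∈S (steps i)) (step-∈S last)
    where
    steps : ∀ (i : Fin (ℕ.suc c)) → Step u (toℕ i)
    steps i = walk-step live (ℕ.m<n⇒m<1+n (toℕ<n i))
    last : Step u (ℕ.suc c)
    last = walk-step live (ℕ.n<1+n (ℕ.suc c))
    cycle : Cycle G
    cycle = record
      { clen      = c
      ; cyc       = λ x → walk u (toℕ x)
      ; cyc-inj   = λ x y eq → toℕ-injective (distinct (toℕ<n x) (toℕ<n y) eq)
      ; cyc-step  = λ i → step-edge (steps i)
                        , trans (step-src (steps i)) (cong (walk u) (sym (toℕ-inject₁ i)))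
                        , step-tgt (steps i)
      ; cyc-close = step-edge last
                  , trans (step-src last) (cong (walk u) (sym (toℕ-fromℕ (ℕ.suc c))))
                  , trans (step-tgt last) closed
      }

  Fresh : V → ℕ → Set
  Fresh v k = ∀ {x} → x < k → walk v x ≢ walk v k

  fresh? : ∀ v → Decidable (Fresh v)
  fresh? v k = ℕ.allUpTo? (λ x → ¬? (walk v x ≟ walk v k)) k

  -- The first vertex of the walk that repeats an earlier one closes a loop or a cycle of S.
  walk-injective : ∀ {v i j} → Live v j → i < j → walk v i ≢ walk v j
  walk-injective {v} {i} {j} live i<j repeat
    with first-failure (fresh? v) (ℕ.suc j) (λ fresh → fresh ℕ.≤-refl i<j repeat)
  ... | m , m<1+j , stale , fresh-below with ℕ.anyUpTo? (λ x → walk v x ≟ walk v m) m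
  ...   | no none = stale (λ x<m eq → none (_ , x<m , eq))
  ...   | yes (x , x<m , first-repeat) = no-closed-walk d live′ closed distinct
    where
    d : ℕ
    d = proj₁ (ℕ.m≤n⇒∃[o]m+o≡n x<m)
    1+d+x≡m : ℕ.suc d + x ≡ m
    1+d+x≡m = trans (cong ℕ.suc (ℕ.+-comm d x)) (proj₂ (ℕ.m≤n⇒∃[o]m+o≡n x<m))
    u : V
    u = walk v x
    shift : ∀ t → walk v (t + x) ≡ walk u t
    shift t = fold-+ v next t
    below-m : ∀ {t} → t < ℕ.suc d → t + x < m
    below-m t<1+d = subst (_ + x <_) 1+d+x≡m (ℕ.+-monoˡ-< x t<1+d)
    live′ : Live u (ℕ.suc d)
    live′ {t} t<1+d = subst HasOut (shift t) (live (ℕ.<-≤-trans (below-m t<1+d) (s≤s⁻¹ m<1+j)))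
    closed : walk u (ℕ.suc d) ≡ u
    closed = trans (sym (shift (ℕ.suc d))) (trans (cong (walk v) 1+d+x≡m) (sym first-repeat))
    ordered : ∀ {a b} → a < b → b < ℕ.suc d → walk u a ≢ walk u b
    ordered {a} {b} a<b b<1+d eq =
      fresh-below (below-m b<1+d) (ℕ.+-monoˡ-< x a<b) (trans (shift a) (trans eq (sym (shift b))))
    distinct : ∀ {a b} → a < ℕ.suc d → b < ℕ.suc d → walk u a ≡ walk u b → a ≡ b
    distinct {a} {b} a<1+d b<1+d eq with ℕ.<-cmp a b
    ... | tri< a<b _ _ = contradiction eq (ordered a<b b<1+d)
    ... | tri≈ _ a≡b _ = a≡b
    ... | tri> _ _ b<a = contradiction (sym eq) (ordered b<a a<1+d)

  start-walks-disjoint : ∀ {s s′ a b} → ¬ HasIn s → ¬ HasIn s′ → Live s a → Live s′ b →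
                         walk s a ≡ walk s′ b → s ≡ s′ × a ≡ b
  start-walks-disjoint {a = ℕ.zero} {ℕ.zero} _ _ _ _ eq = eq , refl
  start-walks-disjoint {s′ = s′} {ℕ.zero} {ℕ.suc b} no-in _ _ live′ eq =
    contradiction (step-edge st , step-∈S st , trans (step-tgt st) (sym eq)) no-in
    where
    st : Step s′ b
    st = walk-step live′ (ℕ.n<1+n b)
  start-walks-disjoint {s} {a = ℕ.suc a} {ℕ.zero} _ no-in′ live _ eq =
    contradiction (step-edge st , step-∈S st , trans (step-tgt st) eq) no-in′
    where
    st : Step s a
    st = walk-step live (ℕ.n<1+n a)
  start-walks-disjoint {s} {s′} {ℕ.suc a} {ℕ.suc b} no-in no-in′ live live′ eq =
    Product.map₂ (cong ℕ.suc)
      (start-walks-disjoint no-in no-in′ (live-≤ (ℕ.n≤1+n a) live) (live-≤ (ℕ.n≤1+n b) live′)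
                            same-src)
    where
    st : Step s a
    st = walk-step live (ℕ.n<1+n a)
    st′ : Step s′ b
    st′ = walk-step live′ (ℕ.n<1+n b)
    same-edge : step-edge st ≡ step-edge st′
    same-edge = tgt-unique (step-∈S st) (step-∈S st′) (trans (step-tgt st) (trans eq (sym (step-tgt st′))))
    same-src : walk s a ≡ walk s′ b
    same-src = trans (sym (step-src st)) (trans (cong (src G) same-edge) (step-src st′))

  walk-ends : ∀ v → ∃[ m ] (Live v m × ¬ HasOut (walk v m))
  walk-ends v =
    let m , _ , stuck , live = first-failure (hasOut? ∘ walk v) (ℕ.suc (nV G)) endless in m , live , stuck
    where
    endless : ¬ Live v (ℕ.suc (nV G))
    endless live =
      let i , j , i<j , eq = pigeonhole (ℕ.n<1+n (nV G)) (walk v ∘ toℕ) in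
      walk-injective (live-≤ (ℕ.<⇒≤ (toℕ<n j)) live) i<j eq

  maximal-walk : ∀ {s} → HasOut s → ∃[ L ] (Live s (ℕ.suc L) × ¬ HasOut (walk s (ℕ.suc L)))
  maximal-walk {s} out = positive (walk-ends s)
    where
    positive : ∃[ m ] (Live s m × ¬ HasOut (walk s m)) →
               ∃[ L ] (Live s (ℕ.suc L) × ¬ HasOut (walk s (ℕ.suc L)))
    positive (ℕ.zero  , _    , stuck) = contradiction out stuck
    positive (ℕ.suc L , live , stuck) = L , live , stuck

  back : V → ℕ → V
  back u k = iterate prev u k

  BackLive : V → ℕ → Set
  BackLive u k = ∀ {j} → j < k → HasIn (back u j)

  walk-back : ∀ {u} m → BackLive u m → walk (back u m) m ≡ u
  walk-back ℕ.zero    _     = refl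
  walk-back (ℕ.suc m) blive =
    trans (cong next (walk-back m (blive ∘ s≤s))) (next-prev (blive (s≤s z≤n)))

  back-live : ∀ {u} m → HasOut u → BackLive u m → Live (back u m) (ℕ.suc m)
  back-live ℕ.zero    out _     = live-extend (λ ()) out
  back-live (ℕ.suc m) out blive =
    live-extend (back-live m (prev-hasOut (blive (s≤s z≤n))) (blive ∘ s≤s))
                (subst HasOut (sym (walk-back (ℕ.suc m) blive)) out)

  back-ends : ∀ {u} → HasOut u → ∃[ m ] (BackLive u m × ¬ HasIn (back u m))
  back-ends {u} out =
    let m , _ , no-in , blive = first-failure (hasIn? ∘ back u) (ℕ.suc (nV G)) endless in m , blive , no-in
    where
    endless : ¬ BackLive u (ℕ.suc (nV G))
    endless blive =
      let i , j , i<j , eq = pigeonhole (ℕ.n<1+n (nV G)) (back u ∘ toℕ)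
          blive≤ : ∀ (k : Fin (ℕ.suc (nV G))) → BackLive u (toℕ k)
          blive≤ k j<k = blive (ℕ.<-trans j<k (toℕ<n k))
      in walk-injective (live-≤ (ℕ.n≤1+n _) (back-live (toℕ j) out (blive≤ j))) i<j (begin
        walk (back u (toℕ j)) (toℕ i)  ≡⟨ cong (λ w → walk w (toℕ i)) eq ⟨
        walk (back u (toℕ i)) (toℕ i)  ≡⟨ walk-back (toℕ i) (blive≤ i) ⟩
        u                              ≡⟨ walk-back (toℕ j) (blive≤ j) ⟨
        walk (back u (toℕ j)) (toℕ j)  ∎)
      where open ≡-Reasoning

  Start : V → Set
  Start v = HasOut v × ¬ HasIn v

  start? : Decidable Start
  start? v = hasOut? v ×-dec ¬? (hasIn? v)

  module FromStart {s} (start : Start s) where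
    L : ℕ
    L = proj₁ (maximal-walk (proj₁ start))

    live : Live s (ℕ.suc L)
    live = proj₁ (proj₂ (maximal-walk (proj₁ start)))

    stuck : ¬ HasOut (walk s (ℕ.suc L))
    stuck = proj₂ (proj₂ (maximal-walk (proj₁ start)))

    live-to : ∀ (x : Fin (ℕ.suc (ℕ.suc L))) → Live s (toℕ x)
    live-to x = live-≤ (s≤s⁻¹ (toℕ<n x)) live

    steps : ∀ (i : Fin (ℕ.suc L)) → Step s (toℕ i)
    steps i = walk-step live (toℕ<n i)

    path : SimplePath G
    path = record
      { len      = L
      ; vert     = walk s ∘ toℕ
      ; edge     = step-edge ∘ steps
      ; vert-inj = λ x y eq → toℕ-injective
                     (proj₂ (start-walks-disjoint (proj₂ start) (proj₂ start) (live-to x) (live-to y) eq))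
      ; edge-src = λ i → trans (step-src (steps i)) (cong (walk s) (sym (toℕ-inject₁ i)))
      ; edge-tgt = step-tgt ∘ steps
      }

    covers : ∀ {e M} → e ∈ S → Live s (ℕ.suc M) → src G e ≡ walk s M → ∃[ i ] edge path i ≡ e
    covers {e} {M} e∈S live-M src-e = position (M ℕ.<? ℕ.suc L)
      where
      position : Dec (M < ℕ.suc L) → ∃[ i ] edge path i ≡ e
      position (no M≮1+L) = contradiction (live-M (s≤s (ℕ.≮⇒≥ M≮1+L))) stuck
      position (yes M<1+L) = fromℕ< M<1+L , src-unique (step-∈S st) e∈S
        (trans (step-src st) (trans (cong (walk s) (toℕ-fromℕ< M<1+L)) (sym src-e)))
        where
        st : Step s (toℕ (fromℕ< M<1+L))
        st = steps (fromℕ< M<1+L)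

  multipath : IsMultipath G S
  multipath = size , paths , disjoint , covered , λ a i → step-∈S (FromStart.steps (elem-satisfies a) i)
    where
    open Enumeration (enumerate start?)
    paths : Fin size → SimplePath G
    paths a = FromStart.path (elem-satisfies a)
    disjoint : ∀ a b i j → vert (paths a) i ≡ vert (paths b) j → a ≡ b
    disjoint a b i j eq = elem-injective (proj₁ (start-walks-disjoint
      (proj₂ (elem-satisfies a)) (proj₂ (elem-satisfies b))
      (FromStart.live-to (elem-satisfies a) i) (FromStart.live-to (elem-satisfies b) j) eq))
    covered : ∀ e → e ∈ S → ∃[ a ] ∃[ i ] edge (paths a) i ≡ e
    covered e e∈S =
      let out = (e , e∈S , refl)
          m , blive , no-in = back-ends out
          live = back-live m out blive
          a , elem-a≡s = elem-surjective (live (s≤s z≤n) , no-in)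
      in a , FromStart.covers (elem-satisfies a) e∈S
               (subst (λ w → Live w (ℕ.suc m)) (sym elem-a≡s) live)
               (trans (sym (walk-back m blive)) (cong (λ w → walk w m) (sym elem-a≡s)))

linearForest⇒multipath : ∀ {G S} → LinearForest G S → IsMultipath G S
linearForest⇒multipath = LinearForestPaths.multipath

module Representation (G : Digraph) where

  V E : Set
  V = Fin (nV G)
  E = Fin (nE G)

  SharesSource SharesTarget : E → Set
  SharesSource e = ∃[ f ] (f ≢ e × src G f ≢ tgt G f × src G f ≡ src G e)
  SharesTarget e = ∃[ f ] (f ≢ e × src G f ≢ tgt G f × tgt G f ≡ tgt G e)

  data Kind : Set where
    loop fan-out fan-in plain : Kind

  data KindSpec (e : E) : Kind → Set where
    is-loop    : src G e ≡ tgt G e → KindSpec e loop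
    is-fan-out : src G e ≢ tgt G e → SharesSource e → KindSpec e fan-out
    is-fan-in  : src G e ≢ tgt G e → ¬ SharesSource e → SharesTarget e → KindSpec e fan-in
    is-plain   : src G e ≢ tgt G e → ¬ SharesSource e → ¬ SharesTarget e → KindSpec e plain

  sharesSource? : Decidable SharesSource
  sharesSource? e = any? λ f → ¬? (f ≟ e) ×-dec ¬? (src G f ≟ tgt G f) ×-dec (src G f ≟ src G e)

  sharesTarget? : Decidable SharesTarget
  sharesTarget? e = any? λ f → ¬? (f ≟ e) ×-dec ¬? (src G f ≟ tgt G f) ×-dec (tgt G f ≟ tgt G e)

  classify : ∀ e → ∃ (KindSpec e)
  classify e with src G e ≟ tgt G e | sharesSource? e | sharesTarget? e
  ... | yes l  | _     | _     = loop    , is-loop l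
  ... | no ¬l  | yes s | _     = fan-out , is-fan-out ¬l s
  ... | no ¬l  | no ¬s | yes t = fan-in  , is-fan-in ¬l ¬s t
  ... | no ¬l  | no ¬s | no ¬t = plain   , is-plain ¬l ¬s ¬t

  kind : E → Kind
  kind e = proj₁ (classify e)

  kind≡ : ∀ {e k} → KindSpec e k → kind e ≡ k
  kind≡ {e} = unique (proj₂ (classify e))
    where
    unique : ∀ {k k′} → KindSpec e k → KindSpec e k′ → k ≡ k′
    unique (is-loop _)        (is-loop _)         = refl
    unique (is-loop l)        (is-fan-out ¬l _)   = contradiction l ¬l
    unique (is-loop l)        (is-fan-in ¬l _ _)  = contradiction l ¬l
    unique (is-loop l)        (is-plain ¬l _ _)   = contradiction l ¬l
    unique (is-fan-out ¬l _)  (is-loop l)         = contradiction l ¬l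
    unique (is-fan-out _ _)   (is-fan-out _ _)    = refl
    unique (is-fan-out _ s)   (is-fan-in _ ¬s _)  = contradiction s ¬s
    unique (is-fan-out _ s)   (is-plain _ ¬s _)   = contradiction s ¬s
    unique (is-fan-in ¬l _ _) (is-loop l)         = contradiction l ¬l
    unique (is-fan-in _ ¬s _) (is-fan-out _ s)    = contradiction s ¬s
    unique (is-fan-in _ _ _)  (is-fan-in _ _ _)   = refl
    unique (is-fan-in _ _ t)  (is-plain _ _ ¬t)   = contradiction t ¬t
    unique (is-plain ¬l _ _)  (is-loop l)         = contradiction l ¬l
    unique (is-plain _ ¬s _)  (is-fan-out _ s)    = contradiction s ¬s
    unique (is-plain _ _ ¬t)  (is-fan-in _ _ t)   = contradiction t ¬t
    unique (is-plain _ _ _)   (is-plain _ _ _)    = refl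

  kindSpec : ∀ e → KindSpec e (kind e)
  kindSpec e = proj₂ (classify e)

  data Row : Set where
    fanOutRow fanInRow vertexRow : V → Row

  entry : Row → Kind → E → Bool
  entry (fanOutRow u) fan-out e = does (src G e ≟ u)
  entry (fanInRow w)  fan-in  e = does (tgt G e ≟ w)
  entry (vertexRow v) plain   e = does (src G e ≟ v) xor does (tgt G e ≟ v)
  entry _             _       _ = false

  M : Row → E → Bool
  M r e = entry r (kind e) e

  rowIndex : Fin (nV G + (nV G + nV G)) → Row
  rowIndex = [ fanOutRow , [ fanInRow , vertexRow ]′ ∘ splitAt (nV G) ]′ ∘ splitAt (nV G)

  rowIndex-surjective : ∀ r → ∃[ i ] rowIndex i ≡ r
  rowIndex-surjective (fanOutRow u) = u ↑ˡ (nV G + nV G) , index-u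
    where
    index-u : rowIndex (u ↑ˡ (nV G + nV G)) ≡ fanOutRow u
    index-u rewrite splitAt-↑ˡ (nV G) u (nV G + nV G) = refl
  rowIndex-surjective (fanInRow w) = nV G ↑ʳ (w ↑ˡ nV G) , index-w
    where
    index-w : rowIndex (nV G ↑ʳ (w ↑ˡ nV G)) ≡ fanInRow w
    index-w rewrite splitAt-↑ʳ (nV G) (nV G + nV G) (w ↑ˡ nV G) | splitAt-↑ˡ (nV G) w (nV G) = refl
  rowIndex-surjective (vertexRow v) = nV G ↑ʳ (nV G ↑ʳ v) , index-v
    where
    index-v : rowIndex (nV G ↑ʳ (nV G ↑ʳ v)) ≡ vertexRow v
    index-v rewrite splitAt-↑ʳ (nV G) (nV G + nV G) (nV G ↑ʳ v) | splitAt-↑ʳ (nV G) (nV G) v = refl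

  mpMatrix : Fin (nV G + (nV G + nV G)) → E → Bool
  mpMatrix = M ∘ rowIndex

  loop-column : ∀ {e} → kind e ≡ loop → ∀ r → M r e ≡ false
  loop-column k (fanOutRow _) rewrite k = refl
  loop-column k (fanInRow _)  rewrite k = refl
  loop-column k (vertexRow _) rewrite k = refl

  fanOutRow-src : ∀ {u e} → M (fanOutRow u) e ≡ true → src G e ≡ u
  fanOutRow-src {u} {e} = at (kind e)
    where
    at : ∀ k → entry (fanOutRow u) k e ≡ true → src G e ≡ u
    at fan-out = does⇒ (src G e ≟ u)
    at loop    = λ ()
    at fan-in  = λ ()
    at plain   = λ ()

  fanInRow-tgt : ∀ {w e} → M (fanInRow w) e ≡ true → tgt G e ≡ w
  fanInRow-tgt {w} {e} = at (kind e)
    where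
    at : ∀ k → entry (fanInRow w) k e ≡ true → tgt G e ≡ w
    at fan-in  = does⇒ (tgt G e ≟ w)
    at loop    = λ ()
    at fan-out = λ ()
    at plain   = λ ()

  vertexRow-ends : ∀ {v e} → M (vertexRow v) e ≡ true → src G e ≡ v ⊎ tgt G e ≡ v
  vertexRow-ends {v} {e} = at (kind e)
    where
    at : ∀ k → entry (vertexRow v) k e ≡ true → src G e ≡ v ⊎ tgt G e ≡ v
    at plain h with src G e ≟ v
    ... | yes src≡v = inj₁ src≡v
    ... | no _      = inj₂ (does⇒ (tgt G e ≟ v) h)
    at loop    = λ ()
    at fan-out = λ ()
    at fan-in  = λ ()

  fanOutRow-pivot : ∀ {e} → kind e ≡ fan-out → M (fanOutRow (src G e)) e ≡ true
  fanOutRow-pivot {e} k rewrite k = dec-true (src G e ≟ src G e) refl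

  fanInRow-pivot : ∀ {e} → kind e ≡ fan-in → M (fanInRow (tgt G e)) e ≡ true
  fanInRow-pivot {e} k rewrite k = dec-true (tgt G e ≟ tgt G e) refl

  vertexRow-incident : ∀ {v e} → kind e ≡ plain → src G e ≢ tgt G e →
                       src G e ≡ v ⊎ tgt G e ≡ v → M (vertexRow v) e ≡ true
  vertexRow-incident {e = e} k ¬l (inj₁ refl)
    rewrite k | dec-true (src G e ≟ src G e) refl | dec-false (tgt G e ≟ src G e) (¬l ∘ sym) = refl
  vertexRow-incident {e = e} k ¬l (inj₂ refl)
    rewrite k | dec-false (src G e ≟ tgt G e) ¬l | dec-true (tgt G e ≟ tgt G e) refl = refl

  fan-out-parallel : ∀ {e f} → kind e ≡ fan-out → kind f ≡ fan-out → src G e ≡ src G f →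
                     ∀ r → M r e ≡ M r f
  fan-out-parallel ke kf same (fanOutRow u) rewrite ke | kf = cong (λ x → does (x ≟ u)) same
  fan-out-parallel ke kf _    (fanInRow _)  rewrite ke | kf = refl
  fan-out-parallel ke kf _    (vertexRow _) rewrite ke | kf = refl

  fan-in-parallel : ∀ {e f} → kind e ≡ fan-in → kind f ≡ fan-in → tgt G e ≡ tgt G f →
                    ∀ r → M r e ≡ M r f
  fan-in-parallel ke kf _    (fanOutRow _) rewrite ke | kf = refl
  fan-in-parallel ke kf same (fanInRow w)  rewrite ke | kf = cong (λ x → does (x ≟ w)) same
  fan-in-parallel ke kf _    (vertexRow _) rewrite ke | kf = refl

module _ (G : Digraph) {S : Subset (nE G)} (mp : IsMultipath G S) where
  open Representation G
  open MultipathEdges mp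

  multipath⇒independent : LinIndepF2 mpMatrix S
  multipath⇒independent c support kernel x = ¬-not λ cx →
    let a , i , edge≡x = on-path (support x cx) in
    vanishes (len (P a) ∸ toℕ i) i (ℕ.m+[n∸m]≡n (s≤s⁻¹ (toℕ<n i))) (trans (cong c edge≡x) cx)
    where
    ker : InKernel M c
    ker = kernel-reindex M rowIndex rowIndex-surjective kernel

    propagates : ∀ {a i} → c (edge (P a) i) ≡ true →
                 ∃[ j ] (toℕ j ≡ ℕ.suc (toℕ i) × c (edge (P a) j) ≡ true)
    propagates {a} {i} ce = by-kind (kindSpec e)
      where
      e : Fin (nE G)
      e = edge (P a) i
      sole : ∀ r → M r e ≡ true → (∀ {f} → c f ≡ true → M r f ≡ true → f ≡ e) → ⊥
      sole = sole-support-∉-kernel M ker ce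
      by-kind : ∀ {k} → KindSpec e k → ∃[ j ] (toℕ j ≡ ℕ.suc (toℕ i) × c (edge (P a) j) ≡ true)
      by-kind (is-loop l) = contradiction l (path-edge-nonloop (P a) i)
      by-kind spec@(is-fan-out _ _) =
        ⊥-elim (sole (fanOutRow (src G e)) (fanOutRow-pivot (kind≡ spec))
                     (λ cf → src-unique (support _ cf) ∘ fanOutRow-src))
      by-kind spec@(is-fan-in _ _ _) =
        ⊥-elim (sole (fanInRow (tgt G e)) (fanInRow-pivot (kind≡ spec))
                     (λ cf → tgt-unique (support _ cf) ∘ fanInRow-tgt))
      by-kind spec@(is-plain ¬l _ _) =
        decidable-stable (any? λ j → (toℕ j ℕ.≟ ℕ.suc (toℕ i)) ×-dec (c (edge (P a) j) Bool.≟ true))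
        λ none →
        sole (vertexRow (tgt G e)) (vertexRow-incident (kind≡ spec) ¬l (inj₂ refl)) λ {f} cf Mf →
        let successor : src G f ≡ tgt G e → f ≡ e
            successor src-f = let j , j≡1+i , f≡ = next-edge (support f cf) src-f in
                              ⊥-elim (none (j , j≡1+i , trans (cong c (sym f≡)) cf))
        in [ successor , tgt-unique (support f cf) ]′ (vertexRow-ends Mf)

    vanishes : ∀ d {a} (i : Fin (ℕ.suc (len (P a)))) → toℕ i + d ≡ len (P a) → c (edge (P a) i) ≢ true
    vanishes ℕ.zero i i+0≡len ce =
      let j , j≡1+i , _ = propagates ce in
      ℕ.<-irrefl (trans j≡1+i (cong ℕ.suc (trans (sym (ℕ.+-identityʳ _)) i+0≡len))) (toℕ<n j)
    vanishes (ℕ.suc d) i i+1+d≡len ce =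
      let j , j≡1+i , cj = propagates ce in
      vanishes d j (trans (cong (_+ d) j≡1+i) (trans (sym (ℕ.+-suc (toℕ i) d)) i+1+d≡len)) cj

module _ (G : Digraph) {S : Subset (nE G)} (indep : LinIndepF2 (Representation.mpMatrix G) S) where
  open Representation G

  independent⇒loopless : ∀ {e} → e ∈ S → src G e ≢ tgt G e
  independent⇒loopless e∈S loop-e =
    independent⇒column≢0 mpMatrix indep e∈S (loop-column (kind≡ (is-loop loop-e)) ∘ rowIndex)

  independent⇒src-unique : ∀ {e f} → e ∈ S → f ∈ S → src G e ≡ src G f → e ≡ f
  independent⇒src-unique {e} {f} e∈S f∈S same = decidable-stable (e ≟ f) λ e≢f →
    independent⇒¬parallel mpMatrix indep e∈S f∈S e≢f (parallel e≢f ∘ rowIndex)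
    where
    ¬le : src G e ≢ tgt G e
    ¬le = independent⇒loopless e∈S
    ¬lf : src G f ≢ tgt G f
    ¬lf = independent⇒loopless f∈S
    parallel : e ≢ f → ∀ r → M r e ≡ M r f
    parallel e≢f = fan-out-parallel (kind≡ (is-fan-out ¬le (f , e≢f ∘ sym , ¬lf , sym same)))
                                    (kind≡ (is-fan-out ¬lf (e , e≢f , ¬le , same))) same

  -- The only use of MP1: a third edge leaving the source of e would span D_A or D_B with e and f.
  merge⇒¬SharesSource : ¬ HasDA G → ¬ HasDB G → ∀ {e f} → e ≢ f → tgt G e ≡ tgt G f →
                        src G e ≢ tgt G e → src G f ≢ tgt G f → ¬ SharesSource e
  merge⇒¬SharesSource noDA noDB {e} {f} e≢f same-tgt ¬le ¬lf (g , g≢e , ¬lg , same-src)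
    with src G f ≟ tgt G g
  ... | yes src-f≡tgt-g = noDA (src G f , src G e , tgt G e , srcs-differ , src-f≢tgt-e , ¬le ,
                                (g , same-src , sym src-f≡tgt-g) , (f , refl , sym same-tgt) , (e , refl , refl))
    where
    srcs-differ : src G f ≢ src G e
    srcs-differ p = e≢f (simple G e f ¬le (sym p) same-tgt)
    src-f≢tgt-e : src G f ≢ tgt G e
    src-f≢tgt-e p = ¬lf (trans p same-tgt)
  ... | no src-f≢tgt-g = noDB (src G f , tgt G e , src G e , tgt G g ,
                               src-f≢tgt-e , srcs-differ , src-f≢tgt-g , ¬le ∘ sym , tgts-differ ,
                               ¬lg ∘ trans same-src ,
                               (f , refl , sym same-tgt) , (e , refl , refl) , (g , same-src , refl))
    where
    srcs-differ : src G f ≢ src G e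
    srcs-differ p = e≢f (simple G e f ¬le (sym p) same-tgt)
    src-f≢tgt-e : src G f ≢ tgt G e
    src-f≢tgt-e p = ¬lf (trans p same-tgt)
    tgts-differ : tgt G e ≢ tgt G g
    tgts-differ p = g≢e (simple G g e ¬lg same-src (sym p))

  independent⇒tgt-unique : MP1 G → ∀ {e f} → e ∈ S → f ∈ S → tgt G e ≡ tgt G f → e ≡ f
  independent⇒tgt-unique (noDA , _ , noDB , _) {e} {f} e∈S f∈S same = decidable-stable (e ≟ f) λ e≢f →
    independent⇒¬parallel mpMatrix indep e∈S f∈S e≢f (parallel e≢f ∘ rowIndex)
    where
    ¬le : src G e ≢ tgt G e
    ¬le = independent⇒loopless e∈S
    ¬lf : src G f ≢ tgt G f
    ¬lf = independent⇒loopless f∈S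
    parallel : e ≢ f → ∀ r → M r e ≡ M r f
    parallel e≢f = fan-in-parallel
      (kind≡ (is-fan-in ¬le (merge⇒¬SharesSource noDA noDB e≢f same ¬le ¬lf)
                            (f , e≢f ∘ sym , ¬lf , sym same)))
      (kind≡ (is-fan-in ¬lf (merge⇒¬SharesSource noDA noDB (e≢f ∘ sym) (sym same) ¬lf ¬le)
                            (e , e≢f , ¬le , same)))
      same

  -- By MP2 the cycle is a component, so its edges are plain and each vertex row meets either
  -- none of them or exactly the two at that vertex.
  module CycleKernel (mp1 : MP1 G) (mp2 : MP2 G) (C : Cycle G)
                     (step∈S : ∀ i → proj₁ (cyc-step C i) ∈ S)
                     (close∈S : proj₁ (cyc-close C) ∈ S) where

    OnCycle : V → Set
    OnCycle v = ∃[ k ] v ≡ cyc C k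

    onCycle? : Decidable OnCycle
    onCycle? v = any? (λ k → v ≟ cyc C k)

    adjacency∈S : ∀ {v w g} (y : Adj G v w) → proj₁ y ∈ S → v ≢ w →
                  src G g ≡ v → tgt G g ≡ w → g ∈ S
    adjacency∈S (y , refl , refl) y∈S v≢w src-g tgt-g =
      subst (_∈ S) (simple G y _ v≢w (sym src-g) (sym tgt-g)) y∈S

    cycle-edge∈S : ∀ {g} → IsCycleEdge G C g → g ∈ S
    cycle-edge∈S (inj₁ (i , src-g , tgt-g)) =
      adjacency∈S (cyc-step C i) (step∈S i) (inject₁≢suc i ∘ cyc-inj C _ _) src-g tgt-g
    cycle-edge∈S (inj₂ (src-g , tgt-g)) =
      adjacency∈S (cyc-close C) close∈S ((λ ()) ∘ cyc-inj C _ _) src-g tgt-g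

    cycle-edge-ends : ∀ {g} → IsCycleEdge G C g → OnCycle (src G g) × OnCycle (tgt G g)
    cycle-edge-ends (inj₁ (i , src-g , tgt-g)) = (inject₁ i , src-g) , (suc i , tgt-g)
    cycle-edge-ends (inj₂ (src-g , tgt-g))     = (fromℕ _ , src-g) , (zero , tgt-g)

    Touching : Fin (nE G) → Set
    Touching g = OnCycle (src G g) ⊎ OnCycle (tgt G g)

    touching∈S : ∀ {g} → Touching g → g ∈ S
    touching∈S t = cycle-edge∈S (mp2 C _ t)

    touching-ends : ∀ {g} → Touching g → OnCycle (src G g) × OnCycle (tgt G g)
    touching-ends t = cycle-edge-ends (mp2 C _ t)

    touching-plain : ∀ {x} → Touching x → kind x ≡ plain
    touching-plain {x} t = kind≡ (is-plain (independent⇒loopless x∈S) unshared-src unshared-tgt)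
      where
      x∈S : x ∈ S
      x∈S = touching∈S t
      unshared-src : ¬ SharesSource x
      unshared-src (g , g≢x , _ , same) = g≢x (independent⇒src-unique
        (touching∈S (inj₁ (Product.map₂ (trans same) (proj₁ (touching-ends t))))) x∈S same)
      unshared-tgt : ¬ SharesTarget x
      unshared-tgt (g , g≢x , _ , same) = g≢x (independent⇒tgt-unique mp1
        (touching∈S (inj₂ (Product.map₂ (trans same) (proj₂ (touching-ends t))))) x∈S same)

    leaving : ∀ k → ∃[ y ] (y ∈ S × src G y ≡ cyc C k)
    leaving k with inject₁-or-fromℕ k
    ... | inj₁ (i , refl) = proj₁ (cyc-step C i) , step∈S i , proj₁ (proj₂ (cyc-step C i))
    ... | inj₂ refl       = proj₁ (cyc-close C) , close∈S , proj₁ (proj₂ (cyc-close C))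

    entering : ∀ k → ∃[ y ] (y ∈ S × tgt G y ≡ cyc C k)
    entering zero    = proj₁ (cyc-close C) , close∈S , proj₂ (proj₂ (cyc-close C))
    entering (suc i) = proj₁ (cyc-step C i) , step∈S i , proj₂ (proj₂ (cyc-step C i))

    c : Fin (nE G) → Bool
    c x = does (onCycle? (src G x))

    support : ∀ x → c x ≡ true → x ∈ S
    support x cx = touching∈S (inj₁ (does⇒ (onCycle? _) cx))

    support-plain : ∀ {x} → c x ≡ true → kind x ≡ plain
    support-plain cx = touching-plain (inj₁ (does⇒ (onCycle? _) cx))

    vertexRow-sum : ∀ v → Dec (OnCycle v) → sumF2 (λ x → c x ∧ M (vertexRow v) x) ≡ false
    vertexRow-sum v (no off) = sumF2-off-support c _ λ x cx → ¬-not λ Mx →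
      let on-src , on-tgt = touching-ends (inj₁ (does⇒ (onCycle? _) cx)) in
      off ([ (λ src≡v → subst OnCycle src≡v on-src) , (λ tgt≡v → subst OnCycle tgt≡v on-tgt) ]′
             (vertexRow-ends Mx))
    vertexRow-sum v (yes (k , v≡k)) =
      trans (sumF2-pair _ out≢in only) (cong₂ _xor_ (cong₂ _∧_ c-out M-out) (cong₂ _∧_ c-in M-in))
      where
      out : Fin (nE G)
      out = proj₁ (leaving k)
      out∈S : out ∈ S
      out∈S = proj₁ (proj₂ (leaving k))
      src-out : src G out ≡ v
      src-out = trans (proj₂ (proj₂ (leaving k))) (sym v≡k)
      in′ : Fin (nE G)
      in′ = proj₁ (entering k)
      in∈S : in′ ∈ S
      in∈S = proj₁ (proj₂ (entering k))
      tgt-in : tgt G in′ ≡ v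
      tgt-in = trans (proj₂ (proj₂ (entering k))) (sym v≡k)
      out≢in : out ≢ in′
      out≢in eq = independent⇒loopless out∈S (trans src-out (trans (sym tgt-in) (cong (tgt G) (sym eq))))
      only : ∀ {x} → c x ∧ M (vertexRow v) x ≡ true → x ≡ out ⊎ x ≡ in′
      only {x} h = Sum.map
        (λ src≡v → independent⇒src-unique x∈S out∈S (trans src≡v (sym src-out)))
        (λ tgt≡v → independent⇒tgt-unique mp1 x∈S in∈S (trans tgt≡v (sym tgt-in)))
        (vertexRow-ends (∧-conicalʳ _ _ h))
        where
        x∈S : x ∈ S
        x∈S = support x (∧-conicalˡ _ _ h)
      c-out : c out ≡ true
      c-out = dec-true (onCycle? _) (k , proj₂ (proj₂ (leaving k)))
      c-in : c in′ ≡ true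
      c-in = dec-true (onCycle? _) (proj₁ (touching-ends (inj₂ (k , proj₂ (proj₂ (entering k))))))
      M-out : M (vertexRow v) out ≡ true
      M-out = vertexRow-incident (support-plain c-out) (independent⇒loopless out∈S) (inj₁ src-out)
      M-in : M (vertexRow v) in′ ≡ true
      M-in = vertexRow-incident (support-plain c-in) (independent⇒loopless in∈S) (inj₂ tgt-in)

    kernel : InKernel M c
    kernel (fanOutRow u) =
      sumF2-off-support c _ λ x cx → cong (λ k → entry (fanOutRow u) k x) (support-plain cx)
    kernel (fanInRow w)  =
      sumF2-off-support c _ λ x cx → cong (λ k → entry (fanInRow w) k x) (support-plain cx)
    kernel (vertexRow v) = vertexRow-sum v (onCycle? v)

  independent⇒acyclic : MP1 G → MP2 G → (C : Cycle G) →
                        (∀ i → proj₁ (cyc-step C i) ∈ S) → proj₁ (cyc-close C) ∈ S → ⊥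
  independent⇒acyclic mp1 mp2 C step∈S close∈S =
    contradiction (trans (sym c-first) (indep c support (kernel ∘ rowIndex) first)) λ ()
    where
    open CycleKernel mp1 mp2 C step∈S close∈S
    first : Fin (nE G)
    first = proj₁ (cyc-step C zero)
    c-first : c first ≡ true
    c-first = dec-true (onCycle? _) (inject₁ zero , proj₁ (proj₂ (cyc-step C zero)))

independent⇒linearForest : ∀ G → IsMPDigraph G → ∀ {S} →
                           LinIndepF2 (Representation.mpMatrix G) S → LinearForest G S
independent⇒linearForest G (mp1 , mp2) indep = record
  { loopless   = independent⇒loopless G indep
  ; src-unique = independent⇒src-unique G indep
  ; tgt-unique = independent⇒tgt-unique G indep mp1
  ; acyclic    = independent⇒acyclic G indep mp1 mp2
  }

theorem4p18 : (G : Digraph) → IsMPDigraph G → BinaryRepresentable (nE G) (IsMultipath G)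
theorem4p18 G mpG = _ , Representation.mpMatrix G , λ S →
  multipath⇒independent G , linearForest⇒multipath ∘ independent⇒linearForest G mpG
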